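{- Let $T$ be a finite tree, and suppose each vertex of $T$ is given a (possibly empty) subset of the labels $\{x,y\}$. Then exactly one of the following holds: (1) there exist two vertex-disjoint paths $P$ and $Q$ in $T$, each from a vertex with label $x$ to a vertex with label $y$ (paths of length $0$ allowed); (2) there exist $v\in V(T)$ and two subtrees $T_x,T_y$ of $T$ with $V(T_x)\cup V(T_y)=V(T)$, $V(T_x)\cap V(T_y)=\{v\}$, such that $T_x$ contains all vertices of $T$ with label $x$ and $T_y$ contains all vertices of $T$ with label $y$. -}

module Defs where

open import Data.Nat using (ℕ; _<_; _≤_)
open import Data.Fin using (Fin)
open import Data.Bool using (Bool; true; false)
open import Data.List using (List; []; _∷_; length)
open import Data.List.Relation.Unary.All using (All)
open import Data.List.Relation.Unary.Unique.Propositional using (Unique)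
open import Data.List.Membership.Propositional using () renaming (_∈_ to _∈ₗ_)
open import Data.Fin.Subset using (Subset; _∈_)
open import Data.Product using (Σ; ∃; _×_; _,_)
open import Data.Sum using (_⊎_)
open import Data.Unit using (⊤)
open import Data.Empty using (⊥)
open import Relation.Nullary using (¬_)
open import Relation.Binary.PropositionalEquality using (_≡_)

Graph : ℕ → Set
Graph n = Fin n → Fin n → Bool

Adj : ∀ {n} → Graph n → Fin n → Fin n → Set
Adj G u v = G u v ≡ true

Chain : ∀ {n} → Graph n → Fin n → List (Fin n) → Set
Chain G u []       = ⊤
Chain G u (w ∷ ws) = Adj G u w × Chain G w ws

lastV : ∀ {n} → Fin n → List (Fin n) → Fin n
lastV u []       = u
lastV u (w ∷ ws) = lastV w ws

IsPath : ∀ {n} → Graph n → Fin n → List (Fin n) → Set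
IsPath G u ws = Chain G u ws × Unique (u ∷ ws)

IsCycle : ∀ {n} → Graph n → Fin n → List (Fin n) → Set
IsCycle G u ws = 2 ≤ length ws × IsPath G u ws × Adj G (lastV u ws) u

Connected : ∀ {n} → Graph n → Set
Connected {n} G = ∀ (u v : Fin n) → ∃ λ ws → Chain G u ws × lastV u ws ≡ v

Acyclic : ∀ {n} → Graph n → Set
Acyclic {n} G = ∀ (u : Fin n) (ws : List (Fin n)) → ¬ IsCycle G u ws

record IsTree {n : ℕ} (G : Graph n) : Set where
  field
    nonempty  : 0 < n
    symmetric : ∀ u v → G u v ≡ G v u
    loopless  : ∀ u → G u u ≡ false
    connected : Connected G
    acyclic   : Acyclic G

-- A subtree of the tree G, given by its vertex set S: S is nonempty and the
-- subgraph induced on S is connected (hence a tree; every subtree of a tree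
-- is the induced subgraph on its vertex set).
IsSubtree : ∀ {n} → Graph n → Subset n → Set
IsSubtree {n} G S =
  (∃ λ (v : Fin n) → v ∈ S) ×
  (∀ (u v : Fin n) → u ∈ S → v ∈ S →
     ∃ λ ws → Chain G u ws × lastV u ws ≡ v × All (_∈ S) ws)

TwoDisjointPaths : ∀ {n} → Graph n → (X Y : Subset n) → Set
TwoDisjointPaths {n} G X Y =
  Σ (Fin n) λ a → Σ (List (Fin n)) λ ps →
  Σ (Fin n) λ b → Σ (List (Fin n)) λ qs →
    IsPath G a ps × a ∈ X × lastV a ps ∈ Y ×
    IsPath G b qs × b ∈ X × lastV b qs ∈ Y ×
    (∀ w → w ∈ₗ (a ∷ ps) → w ∈ₗ (b ∷ qs) → ⊥)

SplitAtVertex : ∀ {n} → Graph n → (X Y : Subset n) → Set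
SplitAtVertex {n} G X Y =
  Σ (Fin n) λ v → Σ (Subset n) λ Tx → Σ (Subset n) λ Ty →
    IsSubtree G Tx × IsSubtree G Ty ×
    (∀ u → u ∈ Tx ⊎ u ∈ Ty) ×
    (v ∈ Tx × v ∈ Ty × (∀ u → u ∈ Tx → u ∈ Ty → u ≡ v)) ×
    (∀ u → u ∈ X → u ∈ Tx) ×
    (∀ u → u ∈ Y → u ∈ Ty)

-- For a vertex w, the components of T − w (the branches at w) are indexed by the neighbour
-- of w through which they are entered. If no branch at w contains both an x- and a
-- y-vertex, taking for Tx the vertex w with the branches that contain an x-vertex and for
-- Ty the vertex w with all other branches gives (2). Otherwise step from w into such a
-- branch and repeat. If at some point the shared branch at the new vertex is the one we
-- came from, both sides of the last edge contain an x- and a y-vertex, and connecting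
-- them inside each side gives (1). The side we enter shrinks strictly at each step, so
-- one of the two cases is reached. Conversely, in (2) an edge from Tx − Ty to Ty − Tx
-- would close a cycle through v, so every path from Tx to Ty passes through v, and two
-- paths as in (1) would both contain v.

module Submission where

open import Defs
open import Data.Nat using (ℕ; suc; _<_; s≤s; z≤n)
open import Data.Nat.Properties using (<-≤-trans; n<1+n)
open import Data.Fin using (Fin; _≟_; fromℕ<)
open import Data.Fin.Subset using (Subset; _∈_)
open import Data.Fin.Subset.Properties using (_∈?_)
open import Data.Fin.Properties using (any?)
open import Data.Vec using (tabulate)
open import Data.Vec.Properties using (lookup∘tabulate; lookup⇒[]=; []=⇒lookup)
open import Data.List using ([]; _∷_; length; filter; allFin)
open import Data.List.Properties using (filter-reject; filter-notAll)
open import Data.List.Membership.Propositional using () renaming (_∈_ to _∈ₗ_)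
open import Data.List.Membership.Propositional.Properties using (∈-allFin; ∈-filter⁺)
open import Data.List.Relation.Unary.All as All using (All; []; _∷_)
open import Data.List.Relation.Unary.All.Properties using (¬Any⇒All¬)
open import Data.List.Relation.Unary.Any as Any using (here; there)
open import Data.List.Relation.Unary.AllPairs using ([]; _∷_)
open import Data.List.Relation.Unary.Unique.Propositional using (Unique)
open import Data.Product using (∃; _×_; _,_; proj₁; proj₂)
open import Data.Sum using (_⊎_; inj₁; inj₂)
open import Data.Unit using (⊤; tt)
open import Data.Empty using (⊥-elim)
open import Function using (_∘_)
open import Relation.Nullary using (¬_; Dec; yes; no; does)
open import Relation.Nullary.Decidable using (dec-true; _×-dec_; _⊎-dec_; ¬?)
open import Level using (0ℓ)
open import Relation.Unary using (Pred; Decidable; _⊆_)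
open import Relation.Binary.PropositionalEquality
  using (_≡_; _≢_; refl; sym; trans; cong; subst)

module _ {a p} {A : Set a} {P Q : Pred A p} (P? : Decidable P) (Q? : Decidable Q) where

  filter-⊆-absorb : P ⊆ Q → ∀ xs → filter P? (filter Q? xs) ≡ filter P? xs
  filter-⊆-absorb P⊆Q [] = refl
  filter-⊆-absorb P⊆Q (x ∷ xs) with Q? x
  ... | no ¬qx = trans (filter-⊆-absorb P⊆Q xs) (sym (filter-reject P? (¬qx ∘ P⊆Q)))
  ... | yes _ with P? x
  ...   | yes _ = cong (x ∷_) (filter-⊆-absorb P⊆Q xs)
  ...   | no _  = filter-⊆-absorb P⊆Q xs

  length-filter-⊂ : P ⊆ Q → ∀ {x xs} → x ∈ₗ xs → Q x → ¬ P x →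
                    length (filter P? xs) < length (filter Q? xs)
  length-filter-⊂ P⊆Q {x} {xs} x∈xs qx ¬px =
    subst (_< length (filter Q? xs)) (cong length (filter-⊆-absorb P⊆Q xs))
      (filter-notAll P? (filter Q? xs) (Any.map (λ { refl → ¬px }) (∈-filter⁺ Q? x∈xs qx)))

module _ {n} {P : Pred (Fin n) 0ℓ} (P? : Decidable P) where

  toSubset : Subset n
  toSubset = tabulate (does ∘ P?)

  ∈-toSubset⁺ : ∀ {u} → P u → u ∈ toSubset
  ∈-toSubset⁺ {u} pu = lookup⇒[]= u _ (trans (lookup∘tabulate _ u) (dec-true (P? u) pu))

  ∈-toSubset⁻ : ∀ {u} → u ∈ toSubset → P u
  ∈-toSubset⁻ {u} u∈ with P? u | trans (sym (lookup∘tabulate (does ∘ P?) u)) ([]=⇒lookup u∈)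
  ... | yes pu | _ = pu

module Walks {n} (G : Graph n) where

  infixr 5 _∷⟨_⟩_

  data Walk (P : Pred (Fin n) 0ℓ) : Fin n → Fin n → Set where
    [_]    : ∀ {u} → P u → Walk P u u
    _∷⟨_⟩_ : ∀ {u w z} → P u → Adj G u w → Walk P w z → Walk P u z

  module _ {P : Pred (Fin n) 0ℓ} where

    head : ∀ {u z} → Walk P u z → P u
    head [ pu ]         = pu
    head (pu ∷⟨ _ ⟩ _) = pu

    last : ∀ {u z} → Walk P u z → P z
    last [ pz ]        = pz
    last (_ ∷⟨ _ ⟩ r) = last r

    _++_ : ∀ {u v z} → Walk P u v → Walk P v z → Walk P u z
    [ _ ]          ++ r′ = r′
    (pu ∷⟨ e ⟩ r) ++ r′ = pu ∷⟨ e ⟩ (r ++ r′)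

    _∷ʳ⟨_⟩_ : ∀ {u v z} → Walk P u v → Adj G v z → P z → Walk P u z
    r ∷ʳ⟨ e ⟩ pz = r ++ (last r ∷⟨ e ⟩ [ pz ])

    reverse : (∀ {u w} → Adj G u w → Adj G w u) → ∀ {u z} → Walk P u z → Walk P z u
    reverse sym-adj [ pu ]         = [ pu ]
    reverse sym-adj (pu ∷⟨ e ⟩ r) = reverse sym-adj r ∷ʳ⟨ sym-adj e ⟩ pu

    fromChain : ∀ {u} ws → Chain G u ws → All P (u ∷ ws) → Walk P u (lastV u ws)
    fromChain []       _        (pu ∷ []) = [ pu ]
    fromChain (w ∷ ws) (e , ch) (pu ∷ ps) = pu ∷⟨ e ⟩ fromChain ws ch ps

    toChain : ∀ {u z} → Walk P u z →
              ∃ λ ws → Chain G u ws × lastV u ws ≡ z × All P (u ∷ ws)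
    toChain [ pu ] = [] , tt , refl , pu ∷ []
    toChain (pu ∷⟨ e ⟩ r) with ws , ch , end , ps ← toChain r =
      _ ∷ ws , (e , ch) , end , pu ∷ ps

  map : ∀ {P Q : Pred (Fin n) 0ℓ} → P ⊆ Q → ∀ {u z} → Walk P u z → Walk Q u z
  map P⊆Q [ pu ]         = [ P⊆Q pu ]
  map P⊆Q (pu ∷⟨ e ⟩ r) = P⊆Q pu ∷⟨ e ⟩ map P⊆Q r

  avoid-unreachable : ∀ {P u z v} → Walk P u z → ¬ Walk P u v → Walk (_≢ v) u z
  avoid-unreachable [ pu ]         ¬uv = [ (λ { refl → ¬uv [ pu ] }) ]
  avoid-unreachable (pu ∷⟨ e ⟩ r) ¬uv =
    (λ { refl → ¬uv [ pu ] }) ∷⟨ e ⟩ avoid-unreachable r (¬uv ∘ (pu ∷⟨ e ⟩_))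

  PathIn : Pred (Fin n) 0ℓ → Fin n → Fin n → Set
  PathIn P u z = ∃ λ ws →
    Chain G u ws × Unique (u ∷ ws) × All P (u ∷ ws) × lastV u ws ≡ z

  module _ {P : Pred (Fin n) 0ℓ} where

    PathIn-suffix : ∀ {u w} ws → u ∈ₗ w ∷ ws → Chain G w ws → Unique (w ∷ ws) →
                    All P (w ∷ ws) → PathIn P u (lastV w ws)
    PathIn-suffix ws (here refl) ch un ps = ws , ch , un , ps , refl
    PathIn-suffix (_ ∷ ws) (there u∈) (_ , ch) (_ ∷ un) (_ ∷ ps) =
      PathIn-suffix ws u∈ ch un ps

    walk⇒path : ∀ {u z} → Walk P u z → PathIn P u z
    walk⇒path [ pu ] = [] , tt , [] ∷ [] , pu ∷ [] , refl
    walk⇒path {u} (pu ∷⟨ e ⟩ r) with walk⇒path r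
    ... | ws , ch , un , ps , end with Any.any? (u ≟_) (_ ∷ ws)
    ...   | yes u∈ with vs , ch′ , un′ , ps′ , end′ ← PathIn-suffix ws u∈ ch un ps =
      vs , ch′ , un′ , ps′ , trans end′ end
    ...   | no u∉ = _ ∷ ws , (e , ch) , ¬Any⇒All¬ _ u∉ ∷ un , pu ∷ ps , end

module Sides {n} {G : Graph n} (T : IsTree G) where

  open IsTree T
  open Walks G

  adj-sym : ∀ {u w} → Adj G u w → Adj G w u
  adj-sym {u} {w} e = trans (symmetric w u) e

  adj⇒≢ : ∀ {u w} → Adj G u w → u ≢ w
  adj⇒≢ {u} e refl with () ← trans (sym e) (loopless u)

  -- For an edge ab, Side a b is the vertex set of the component of T − a containing b.
  Side : Fin n → Fin n → Pred (Fin n) 0ℓ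
  Side a = Walk (_≢ a)

  no-detour : ∀ {a b m} → Adj G a b → Adj G a m → m ≢ b → ¬ Side a b m
  no-detour {a} ab am m≢b r with walk⇒path r
  ... | [] , _ , _ , _ , end = m≢b (sym end)
  ... | p ∷ ps , ch , un , ≢a , end =
    acyclic a (_ ∷ p ∷ ps)
      ( s≤s (s≤s z≤n)
      , ((ab , ch) , All.map (_∘ sym) ≢a ∷ un)
      , subst (λ t → Adj G t a) (sym end) (adj-sym am) )

  sides-disjoint : ∀ {a b z} → Adj G a b → Side b a z → ¬ Side a b z
  sides-disjoint {a} {b} ab = go (λ r → last r refl)
    where
    -- Invariant along the walk from a: b cannot reach the current vertex while avoiding a.
    go : ∀ {q z} → ¬ Side a b q → Walk (_≢ b) q z → ¬ Side a b z
    go ¬bq [ _ ] = ¬bq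
    go {q} ¬bq (_∷⟨_⟩_ {w = q′} _ qq′ r) = go ¬bq′ r
      where
      ¬bq′ : ¬ Side a b q′
      ¬bq′ R with q ≟ a
      ... | yes refl = no-detour ab qq′ (head r) R
      ... | no q≢a   = ¬bq (R ∷ʳ⟨ adj-sym qq′ ⟩ q≢a)

  private
    first-step : ∀ w u → ∃ λ t → u ≢ w → Adj G w t × Side w t u
    first-step w u with ws , ch , end ← connected w u
      with walk⇒path (fromChain {P = λ _ → ⊤} ws ch (All.universal (λ _ → tt) _))
    ... | [] , _ , _ , _ , end′ = w , λ u≢w → ⊥-elim (u≢w (sym (trans end′ end)))
    ... | t ∷ ps , (wt , ch′) , (w≢ ∷ _) , _ , end′ =
      t , λ _ → wt , subst (Side w t) (trans end′ end) (fromChain ps ch′ (All.map (_∘ sym) w≢))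

  -- The neighbour of w on the path to u (junk when u ≡ w).
  towards : Fin n → Fin n → Fin n
  towards w u = proj₁ (first-step w u)

  towards-spec : ∀ {w u} → u ≢ w → Adj G w (towards w u) × Side w (towards w u) u
  towards-spec {w} {u} = proj₂ (first-step w u)

  towards-unique : ∀ {v w z} → Adj G v w → Side v w z → towards v z ≡ w
  towards-unique {v} {w} {z} vw r with towards v z ≟ w
  ... | yes t≡w = t≡w
  ... | no t≢w  with vt , rt ← towards-spec (last r) =
    ⊥-elim (no-detour vw vt t≢w (r ++ reverse adj-sym rt))

  -- A decidable description of Side v w for an edge vw (Side⇒Beyond, Beyond⇒Side).
  Beyond : Fin n → Fin n → Pred (Fin n) 0ℓ
  Beyond v w z = z ≢ v × towards v z ≡ w

  Beyond? : ∀ v w → Decidable (Beyond v w)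
  Beyond? v w z = ¬? (z ≟ v) ×-dec (towards v z ≟ w)

  Beyond⇒Adj : ∀ {v w z} → Beyond v w z → Adj G v w
  Beyond⇒Adj (z≢v , refl) = proj₁ (towards-spec z≢v)

  Beyond⇒Side : ∀ {v w} → Beyond v w ⊆ Side v w
  Beyond⇒Side (z≢v , refl) = proj₂ (towards-spec z≢v)

  Side⇒Beyond : ∀ {v w} → Adj G v w → Side v w ⊆ Beyond v w
  Side⇒Beyond vw r = last r , towards-unique vw r

  walk-within-side : ∀ {w t a b} → Side w t a → Walk (_≢ w) a b → Walk (Side w t) a b
  walk-within-side s [ _ ]          = [ s ]
  walk-within-side s (_ ∷⟨ e ⟩ r) = s ∷⟨ e ⟩ walk-within-side (s ∷ʳ⟨ e ⟩ head r) r

  side-shift : ∀ {v w u} → Adj G v w → Adj G w u → u ≢ v → Side w u ⊆ Side v w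
  side-shift {v} {w} {u} vw wu u≢v r = (adj⇒≢ vw ∘ sym) ∷⟨ wu ⟩ avoid-unreachable r ¬uv
    where
    ¬uv : ¬ Side w u v
    ¬uv = sides-disjoint wu (adj⇒≢ wu ∷⟨ adj-sym vw ⟩ [ u≢v ∘ sym ])

  side-size : Fin n → Fin n → ℕ
  side-size v w = length (filter (Beyond? v w) (allFin n))

  side-size-shrinks : ∀ {v w u} → Adj G v w → Adj G w u → u ≢ v → side-size w u < side-size v w
  side-size-shrinks {v} {w} {u} vw wu u≢v =
    length-filter-⊂ (Beyond? w u) (Beyond? v w)
      (Side⇒Beyond vw ∘ side-shift vw wu u≢v ∘ Beyond⇒Side)
      (∈-allFin w) (Side⇒Beyond vw [ adj⇒≢ vw ∘ sym ]) (λ w∈ → proj₁ w∈ refl)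

  hub⇒IsSubtree : ∀ {S : Subset n} {c} → c ∈ S →
                  (∀ {u} → u ∈ S → Walk (_∈ S) u c) → IsSubtree G S
  hub⇒IsSubtree {S} c∈S to-c = (_ , c∈S) , connect
    where
    connect : ∀ u v → u ∈ S → v ∈ S →
              ∃ λ ws → Chain G u ws × lastV u ws ≡ v × All (_∈ S) ws
    connect u v u∈S v∈S
      with ws , ch , end , _ ∷ ∈S ← toChain (to-c u∈S ++ reverse adj-sym (to-c v∈S)) =
      ws , ch , end , ∈S

  IsSubtree⇒Walk : ∀ {S : Subset n} → IsSubtree G S →
                   ∀ {u v} → u ∈ S → v ∈ S → Walk (_∈ S) u v
  IsSubtree⇒Walk (_ , connect) u∈S v∈S with ws , ch , end , ∈S ← connect _ _ u∈S v∈S =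
    subst (Walk _ _) end (fromChain ws ch (u∈S ∷ ∈S))

  module Separation {Tx Ty : Subset n} {v} (Tx-subtree : IsSubtree G Tx) (Ty-subtree : IsSubtree G Ty)
           (cover : ∀ u → u ∈ Tx ⊎ u ∈ Ty) (v∈Tx : v ∈ Tx) (v∈Ty : v ∈ Ty)
           (meet : ∀ u → u ∈ Tx → u ∈ Ty → u ≡ v) where

    -- Such an edge would close a cycle with the walks to v inside Tx and inside Ty.
    no-crossing-edge : ∀ {c d} → c ∈ Tx → ¬ c ∈ Ty → d ∈ Ty → ¬ d ∈ Tx → ¬ Adj G c d
    no-crossing-edge c∈Tx c∉Ty d∈Ty d∉Tx cd =
      sides-disjoint cd
        (map (λ z∈Tx → λ { refl → d∉Tx z∈Tx }) (IsSubtree⇒Walk Tx-subtree c∈Tx v∈Tx))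
        (map (λ z∈Ty → λ { refl → c∉Ty z∈Ty }) (IsSubtree⇒Walk Ty-subtree d∈Ty v∈Ty))

    walk-across-meets : ∀ {c} ws → c ∈ Tx → Chain G c ws → lastV c ws ∈ Ty → v ∈ₗ c ∷ ws
    walk-across-meets {c} ws c∈Tx ch end∈Ty with c ∈? Ty
    ... | yes c∈Ty = here (sym (meet c c∈Tx c∈Ty))
    walk-across-meets []       c∈Tx _        end∈Ty | no c∉Ty = ⊥-elim (c∉Ty end∈Ty)
    walk-across-meets (d ∷ ds) c∈Tx (cd , ch) end∈Ty | no c∉Ty with cover d | d ∈? Tx
    ... | _        | yes d∈Tx = there (walk-across-meets ds d∈Tx ch end∈Ty)
    ... | inj₁ d∈Tx | no d∉Tx = ⊥-elim (d∉Tx d∈Tx)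
    ... | inj₂ d∈Ty | no d∉Tx = ⊥-elim (no-crossing-edge c∈Tx c∉Ty d∈Ty d∉Tx cd)

  split-blocks-disjoint-paths : ∀ {X Y} → SplitAtVertex G X Y → ¬ TwoDisjointPaths G X Y
  split-blocks-disjoint-paths
    (v , Tx , Ty , Tx-subtree , Ty-subtree , cover , (v∈Tx , v∈Ty , meet) , X⊆Tx , Y⊆Ty)
    (a , ps , b , qs , (chp , _) , a∈X , endp∈Y , (chq , _) , b∈X , endq∈Y , disjoint) =
    disjoint v (walk-across-meets ps (X⊆Tx a a∈X) chp (Y⊆Ty _ endp∈Y))
               (walk-across-meets qs (X⊆Tx b b∈X) chq (Y⊆Ty _ endq∈Y))
    where open Separation Tx-subtree Ty-subtree cover v∈Tx v∈Ty meet

module Alternatives {n} {G : Graph n} (T : IsTree G) (X Y : Subset n) where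

  open IsTree T
  open Walks G
  open Sides T

  HasXY : Pred (Fin n) 0ℓ → Set
  HasXY S = (∃ λ x → x ∈ X × S x) × (∃ λ y → y ∈ Y × S y)

  HasXY? : ∀ {S} → Decidable S → Dec (HasXY S)
  HasXY? S? = any? (λ x → x ∈? X ×-dec S? x) ×-dec any? (λ y → y ∈? Y ×-dec S? y)

  HasXY-mono : ∀ {S S′} → S ⊆ S′ → HasXY S → HasXY S′
  HasXY-mono S⊆S′ ((x , x∈X , sx) , (y , y∈Y , sy)) =
    (x , x∈X , S⊆S′ sx) , (y , y∈Y , S⊆S′ sy)

  SharedBranch : Fin n → Set
  SharedBranch w = ∃ λ t → HasXY (Beyond w t)

  SharedBranch? : Decidable SharedBranch
  SharedBranch? w = any? λ t → HasXY? (Beyond? w t)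

  shared-branch-edge : ∀ {w} → SharedBranch w → ∃ λ t → Adj G w t × HasXY (Side w t)
  shared-branch-edge (t , xy@((_ , _ , x-beyond) , _)) =
    t , Beyond⇒Adj x-beyond , HasXY-mono Beyond⇒Side xy

  branch-union-subtree : ∀ {w} {R : Pred (Fin n) 0ℓ} (R? : Decidable R) →
    (∀ {u z} → u ≢ w → Beyond w (towards w u) z → R u → R z) →
    IsSubtree G (toSubset (λ u → (u ≟ w) ⊎-dec R? u))
  branch-union-subtree {w} {R} R? closed =
    hub⇒IsSubtree (∈-toSubset⁺ S? (inj₁ refl))
                  (map (∈-toSubset⁺ S?) ∘ to-w ∘ ∈-toSubset⁻ S?)
    where
    S? : Decidable (λ u → u ≡ w ⊎ R u)
    S? u = (u ≟ w) ⊎-dec R? u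

    to-w : ∀ {u} → u ≡ w ⊎ R u → Walk (λ z → z ≡ w ⊎ R z) u w
    to-w (inj₁ refl) = [ inj₁ refl ]
    to-w {u} (inj₂ ru) with u ≟ w
    ... | yes refl = [ inj₁ refl ]
    ... | no u≢w with wt , su ← towards-spec u≢w =
      map (λ sz → inj₂ (closed u≢w (Side⇒Beyond wt sz) ru))
          (walk-within-side su (reverse adj-sym su))
        ∷ʳ⟨ adj-sym wt ⟩ inj₁ refl

  split-at : ∀ w → ¬ SharedBranch w → SplitAtVertex G X Y
  split-at w ¬shared =
    w , toSubset Tx? , toSubset Ty? ,
    branch-union-subtree XBranch? (λ { _ (z≢w , tz≡tu) (x , x∈X , x≢w , tx≡tu) →
                                        x , x∈X , x≢w , trans tx≡tu (sym tz≡tu) }) ,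
    branch-union-subtree (¬? ∘ XBranch?) (λ { _ (z≢w , tz≡tu) ¬xu (x , x∈X , x≢w , tx≡tz) →
                                               ¬xu (x , x∈X , x≢w , trans tx≡tz tz≡tu) }) ,
    cover , (∈-toSubset⁺ Tx? (inj₁ refl) , ∈-toSubset⁺ Ty? (inj₁ refl) , meet) , X⊆Tx , Y⊆Ty
    where
    XBranch : Pred (Fin n) 0ℓ
    XBranch u = ∃ λ x → x ∈ X × Beyond w (towards w u) x

    XBranch? : Decidable XBranch
    XBranch? u = any? λ x → x ∈? X ×-dec Beyond? w (towards w u) x

    Tx? : Decidable (λ u → u ≡ w ⊎ XBranch u)
    Tx? u = (u ≟ w) ⊎-dec XBranch? u

    Ty? : Decidable (λ u → u ≡ w ⊎ ¬ XBranch u)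
    Ty? u = (u ≟ w) ⊎-dec ¬? (XBranch? u)

    cover : ∀ u → u ∈ toSubset Tx? ⊎ u ∈ toSubset Ty?
    cover u with XBranch? u
    ... | yes xu = inj₁ (∈-toSubset⁺ Tx? (inj₂ xu))
    ... | no ¬xu = inj₂ (∈-toSubset⁺ Ty? (inj₂ ¬xu))

    meet : ∀ u → u ∈ toSubset Tx? → u ∈ toSubset Ty? → u ≡ w
    meet u u∈Tx u∈Ty with ∈-toSubset⁻ Tx? u∈Tx | ∈-toSubset⁻ Ty? u∈Ty
    ... | inj₁ u≡w | _        = u≡w
    ... | inj₂ _   | inj₁ u≡w = u≡w
    ... | inj₂ xu  | inj₂ ¬xu = ⊥-elim (¬xu xu)

    X⊆Tx : ∀ u → u ∈ X → u ∈ toSubset Tx?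
    X⊆Tx u u∈X with u ≟ w
    ... | yes u≡w = ∈-toSubset⁺ Tx? (inj₁ u≡w)
    ... | no u≢w  = ∈-toSubset⁺ Tx? (inj₂ (u , u∈X , u≢w , refl))

    Y⊆Ty : ∀ u → u ∈ Y → u ∈ toSubset Ty?
    Y⊆Ty u u∈Y with u ≟ w
    ... | yes u≡w = ∈-toSubset⁺ Ty? (inj₁ u≡w)
    ... | no u≢w  = ∈-toSubset⁺ Ty? (inj₂ λ (x , x∈X , x-beyond) →
                      ¬shared (towards w u , (x , x∈X , x-beyond) , (u , u∈Y , u≢w , refl)))

  path-within-side : ∀ {v w x y} → Side v w x → Side v w y → PathIn (Side v w) x y
  path-within-side sx sy = walk⇒path (walk-within-side sx (reverse adj-sym sx ++ sy))

  paths-across-edge : ∀ {v w} → Adj G v w → HasXY (Side v w) → HasXY (Side w v) →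
                      TwoDisjointPaths G X Y
  paths-across-edge vw ((x , x∈X , sx) , (y , y∈Y , sy))
                       ((x′ , x′∈X , sx′) , (y′ , y′∈Y , sy′))
    with ps , chp , unp , inp , endp ← path-within-side sx sy
       | qs , chq , unq , inq , endq ← path-within-side sx′ sy′ =
    x , ps , x′ , qs ,
    (chp , unp) , x∈X , subst (_∈ Y) (sym endp) y∈Y ,
    (chq , unq) , x′∈X , subst (_∈ Y) (sym endq) y′∈Y ,
    λ z z∈p z∈q → sides-disjoint vw (All.lookup inq z∈q) (All.lookup inp z∈p)

  descend : ∀ k {v w} → Adj G v w → side-size v w < k → HasXY (Side v w) →
            TwoDisjointPaths G X Y ⊎ SplitAtVertex G X Y
  descend (suc k) {v} {w} vw (s≤s size≤k) xy with SharedBranch? w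
  ... | no ¬shared = inj₂ (split-at w ¬shared)
  ... | yes shared with t , wt , xy′ ← shared-branch-edge shared | t ≟ v
  ...   | yes refl = inj₁ (paths-across-edge vw xy xy′)
  ...   | no t≢v   = descend k wt (<-≤-trans (side-size-shrinks vw wt t≢v) size≤k) xy′

  alternative-holds : TwoDisjointPaths G X Y ⊎ SplitAtVertex G X Y
  alternative-holds with SharedBranch? (fromℕ< nonempty)
  ... | no ¬shared = inj₂ (split-at _ ¬shared)
  ... | yes shared with t , rt , xy ← shared-branch-edge shared =
    descend (suc (side-size _ t)) rt (n<1+n _) xy

lemma5p1 : (n : ℕ) (G : Graph n) → IsTree G → (X Y : Subset n) →
    (TwoDisjointPaths G X Y ⊎ SplitAtVertex G X Y) ×
    ¬ (TwoDisjointPaths G X Y × SplitAtVertex G X Y)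
lemma5p1 n G T X Y =
  Alternatives.alternative-holds T X Y ,
  λ (paths , split) → Sides.split-blocks-disjoint-paths T split paths
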